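{- Let $\mathcal P$ be a $d$-floorplan with at least two blocks, let $q$ be a corner of the bounding box of $\mathcal P$, let $B$ be the block containing $q$ and $\bar q$ the corner of $B$ opposite to $q$. Then $B$ has a unique shifting facet, i.e. there is exactly one facet $f$ of $B$ containing $\bar q$, not contained in the boundary of the bounding box, such that $b(f)=f$.
   Context: A $d$-dimensional floorplan is a box (bounding box) partitioned into finitely many boxes (blocks) with pairwise disjoint interiors. A facet of axis $j$ is an axis-parallel hyperrectangle whose $j$-th interval is a point; its interior replaces each nondegenerate closed interval by the open one. The border of axis $j$ at a position $t$ strictly inside the bounding box's $j$-range is the union of all block facets of axis $j$ in the hyperplane $x_j=t$; $b(f)$ denotes the border containing an inner facet $f$. A $d$-floorplan is one in which every border is a single facet (generic) and no two borders have intersecting interiors (tatami condition). Two corners of a box are opposite if they differ in every coordinate.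
   Formalization: Floorplans and their facets lie in ℚ^d instead of d-dimensional Euclidean space, so border positions are rational too. -}

module Defs where

open import Data.Nat using (ℕ; _≤_)
open import Data.Fin using (Fin)
open import Data.Bool using (Bool; true; false; if_then_else_; not)
open import Data.Rational using (ℚ) renaming (_≤_ to _≤q_; _<_ to _<q_)
open import Data.Product using (Σ; ∃; ∃-syntax; _×_; _,_)
open import Data.Sum using (_⊎_)
open import Relation.Binary.PropositionalEquality using (_≡_; _≢_)
open import Relation.Nullary using (¬_)

Point : ℕ → Set
Point d = Fin d → ℚ

record Box (d : ℕ) : Set where
  field
    lo hi : Fin d → ℚ
    lo<hi : ∀ i → lo i <q hi i
open Box public

_∈B_ : ∀ {d} → Point d → Box d → Set
x ∈B B = ∀ i → (lo B i ≤q x i) × (x i ≤q hi B i)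

_∈B°_ : ∀ {d} → Point d → Box d → Set
x ∈B° B = ∀ i → (lo B i <q x i) × (x i <q hi B i)

corner : ∀ {d} → Box d → (Fin d → Bool) → Point d
corner B c i = if c i then hi B i else lo B i

OnBoundary : ∀ {d} → Point d → Box d → Set
OnBoundary x B = (x ∈B B) × ∃[ i ] (x i ≡ lo B i ⊎ x i ≡ hi B i)

-- A facet of axis j: an axis-parallel hyperrectangle whose j-th interval
-- is the point {pos}; the other intervals are [lo i , hi i] (lo i ≤ hi i).
record Facet (d : ℕ) : Set where
  field
    axis : Fin d
    pos  : ℚ
    flo fhi : Fin d → ℚ
    flo≤fhi : ∀ i → flo i ≤q fhi i
open Facet public

_∈F_ : ∀ {d} → Point d → Facet d → Set
x ∈F f = (x (axis f) ≡ pos f) ×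
         (∀ i → i ≢ axis f → (flo f i ≤q x i) × (x i ≤q fhi f i))

-- relative interior: nondegenerate intervals are replaced by open ones
_∈F°_ : ∀ {d} → Point d → Facet d → Set
x ∈F° f = (x (axis f) ≡ pos f) ×
          (∀ i → i ≢ axis f →
             ((flo f i ≡ fhi f i) × (x i ≡ flo f i))
             ⊎ ((flo f i <q x i) × (x i <q fhi f i)))

blockFacet : ∀ {d} → Box d → Fin d → Bool → Facet d
blockFacet B j s = record
  { axis = j
  ; pos = if s then hi B j else lo B j
  ; flo = lo B
  ; fhi = hi B
  ; flo≤fhi = λ i → Data.Rational.Properties.<⇒≤ (lo<hi B i) }
  where import Data.Rational.Properties

record Floorplan (d : ℕ) : Set where
  field
    nBlocks : ℕ
    bbox    : Box d
    block   : Fin nBlocks → Box d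
    blockInside : ∀ k x → x ∈B block k → x ∈B bbox
    covers  : ∀ x → x ∈B bbox → ∃[ k ] (x ∈B block k)
    disjointInteriors : ∀ k l → k ≢ l → ¬ (∃[ x ] ((x ∈B° block k) × (x ∈B° block l)))
open Floorplan public

InnerPos : ∀ {d} → Floorplan d → Fin d → ℚ → Set
InnerPos P j t = (lo (bbox P) j <q t) × (t <q hi (bbox P) j)

InBorder : ∀ {d} → Floorplan d → Fin d → ℚ → Point d → Set
InBorder P j t x = ∃[ k ] ∃[ s ] ((pos (blockFacet (block P k) j s) ≡ t)
                                  × (x ∈F blockFacet (block P k) j s))

BorderIs : ∀ {d} → Floorplan d → Fin d → ℚ → Facet d → Set
BorderIs P j t f = ∀ x → (InBorder P j t x → x ∈F f) × (x ∈F f → InBorder P j t x)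

Generic : ∀ {d} → Floorplan d → Set
Generic {d} P = ∀ j t → InnerPos P j t → (∃[ x ] InBorder P j t x) →
                Σ (Facet d) (λ f → (axis f ≡ j) × BorderIs P j t f)

Tatami : ∀ {d} → Floorplan d → Set
Tatami {d} P = ∀ j t j' t' → InnerPos P j t → InnerPos P j' t' →
               ¬ ((j ≡ j') × (t ≡ t')) →
               (f g : Facet d) → BorderIs P j t f → BorderIs P j' t' g →
               ¬ (∃[ x ] ((x ∈F° f) × (x ∈F° g)))

IsDFloorplan : ∀ {d} → Floorplan d → Set
IsDFloorplan P = Generic P × Tatami P

InBBoxBoundary : ∀ {d} → Floorplan d → Facet d → Set
InBBoxBoundary P f = ∀ x → x ∈F f → OnBoundary x (bbox P)

-- b(f) = f  (for an inner facet f of axis j at position t, b(f) is the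
-- border of axis j at position t).
SelfBorder : ∀ {d} → Floorplan d → Facet d → Set
SelfBorder P f = BorderIs P (axis f) (pos f) f

Shifting : ∀ {d} → Floorplan d → Box d → Point d → Fin d → Bool → Set
Shifting P B q̄ j s = (q̄ ∈F blockFacet B j s)
                   × ¬ InBBoxBoundary P (blockFacet B j s)
                   × SelfBorder P (blockFacet B j s)

{-# OPTIONS --safe #-}
-- Orient every axis from q towards q̄; then B and the bounding box share their near ends. Call an
-- axis i inner when the far facet of B of axis i (the one through q̄) is not on the boundary of the
-- bounding box, and say that j overhangs i when the border through the far facet of axis j reaches
-- beyond q̄ along i. A facet through q̄ is shifting exactly when its axis is inner and overhangs no
-- inner axis. By the tatami condition overhanging is asymmetric: two mutually overhanging borders
-- would share the relative interior points of the ridge where the two far facets of B meet. And in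
-- every set S of inner axes some axis overhangs all the others: the block containing a point just
-- beyond q̄ along S (and inside B along the other axes) does not overlap B, so one of its near facets
-- lies in the hyperplane of the far facet of B of some j in S, and carries the border of j beyond q̄
-- along the rest of S. Hence overhanging is a transitive tournament on the inner axes, which exist
-- because B is not the whole box, and its unique sink is the axis of the unique shifting facet.

module Submission where

open import Defs
open import Data.Nat using (ℕ; _≤_; s≤s)
open import Data.Fin using (Fin; zero; punchIn; _≟_)
open import Data.Fin.Properties using (punchInᵢ≢i; any?)
open import Data.Bool using (Bool; true; false; if_then_else_; not)
open import Data.Rational using (ℚ) renaming (_≤_ to _≤q_; _<_ to _<q_)
open import Data.Rational.Properties
  using (≤-refl; ≤-trans; ≤-antisym; ≤-total; <⇒≤; <-irrefl; <-trans; <-≤-trans; ≤-<-trans; ≮⇒≥; <-dense; _<?_)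
  renaming (_≟_ to _≟q_)
open import Data.Vec.Functional using (updateAt)
open import Data.Vec.Functional.Properties using (updateAt-updates; updateAt-minimal)
open import Data.List using (List; []; _∷_; allFin)
open import Data.List.Relation.Unary.Any using (here; there)
open import Data.List.Membership.Propositional using (_∈_)
open import Data.List.Membership.Propositional.Properties using (∈-allFin)
open import Data.Product using (Σ; ∃; ∃-syntax; _×_; _,_; proj₁; proj₂)
open import Data.Sum using (_⊎_; inj₁; inj₂)
open import Data.Empty using (⊥; ⊥-elim)
open import Function using (const; _∘_)
open import Level using (Level; 0ℓ; _⊔_)
open import Relation.Binary using (Rel)
open import Relation.Binary.PropositionalEquality using (_≡_; _≢_; refl; sym; trans; subst)
open import Relation.Nullary using (¬_; Dec; yes; no)
open import Relation.Nullary.Decidable using (_×-dec_; _⊎-dec_)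
open import Relation.Unary using (Pred; Decidable; Satisfiable; _⊆_)

private
  variable
    d : ℕ
    a b c l h : ℚ

Dominates : ∀ {n r t} → Rel (Fin n) r → Pred (Fin n) t → Fin n → Set (r ⊔ t)
Dominates _⇝_ T j = ∀ {i} → T i → i ≢ j → j ⇝ i

module Tournaments {n : ℕ} {s r : Level} (S : Pred (Fin n) s) (S? : Decidable S) (_⇝_ : Rel (Fin n) r) where

  IsSink : Fin n → Set (s ⊔ r)
  IsSink j = S j × (∀ {i} → S i → i ≢ j → ¬ j ⇝ i)

  module _
    (⇝-asym : ∀ {i j} → S i → S j → i ≢ j → i ⇝ j → ¬ j ⇝ i)
    (dominator : ∀ (T : Pred (Fin n) 0ℓ) → Decidable T → T ⊆ S → Satisfiable T → ∃ λ j → T j × Dominates _⇝_ T j)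
    where

    ⇝-total : ∀ {i j} → S i → S j → i ≢ j → i ⇝ j ⊎ j ⇝ i
    ⇝-total {i} {j} Si Sj i≢j
      with dominator (λ m → m ≡ i ⊎ m ≡ j) (λ m → (m ≟ i) ⊎-dec (m ≟ j))
                     (λ { (inj₁ refl) → Si ; (inj₂ refl) → Sj }) (i , inj₁ refl)
    ... | _ , inj₁ refl , dom = inj₁ (dom (inj₂ refl) (i≢j ∘ sym))
    ... | _ , inj₂ refl , dom = inj₂ (dom (inj₁ refl) i≢j)

    ⇝-trans : ∀ {i j m} → S i → S j → S m → i ≢ j → j ≢ m → i ≢ m → i ⇝ j → j ⇝ m → i ⇝ m
    ⇝-trans {i} {j} {m} Si Sj Sm i≢j j≢m i≢m i⇝j j⇝m
      with dominator (λ x → x ≡ i ⊎ x ≡ j ⊎ x ≡ m) (λ x → (x ≟ i) ⊎-dec ((x ≟ j) ⊎-dec (x ≟ m)))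
                     (λ { (inj₁ refl) → Si ; (inj₂ (inj₁ refl)) → Sj ; (inj₂ (inj₂ refl)) → Sm }) (i , inj₁ refl)
    ... | _ , inj₁ refl , dom = dom (inj₂ (inj₂ refl)) (i≢m ∘ sym)
    ... | _ , inj₂ (inj₁ refl) , dom = ⊥-elim (⇝-asym Si Sj i≢j i⇝j (dom (inj₁ refl) i≢j))
    ... | _ , inj₂ (inj₂ refl) , dom = ⊥-elim (⇝-asym Sj Sm j≢m j⇝m (dom (inj₂ (inj₁ refl)) j≢m))

    sink-unique : ∀ {i j} → IsSink i → IsSink j → i ≡ j
    sink-unique {i} {j} (Si , i-sink) (Sj , j-sink) with i ≟ j
    ... | yes i≡j = i≡j
    ... | no i≢j with ⇝-total Si Sj i≢j
    ...   | inj₁ i⇝j = ⊥-elim (i-sink Sj (i≢j ∘ sym) i⇝j)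
    ...   | inj₂ j⇝i = ⊥-elim (j-sink Si i≢j j⇝i)

    private
      sink-among : Satisfiable S → (L : List (Fin n)) →
                   ∃ λ j → S j × (∀ {i} → i ∈ L → S i → i ≢ j → ¬ j ⇝ i)
      sink-among (j₀ , Sj₀) [] = j₀ , Sj₀ , λ ()
      sink-among S≠∅ (a ∷ L) with sink-among S≠∅ L
      ... | j , Sj , j-sink with S? a | a ≟ j
      ...   | no ¬Sa | _ = j , Sj , λ { (here refl) Sa → ⊥-elim (¬Sa Sa) ; (there i∈L) → j-sink i∈L }
      ...   | yes _ | yes refl = j , Sj , λ { (here refl) _ a≢a → ⊥-elim (a≢a refl) ; (there i∈L) → j-sink i∈L }
      ...   | yes Sa | no a≢j with ⇝-total Sj Sa (a≢j ∘ sym)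
      ...     | inj₂ a⇝j = j , Sj , λ { (here refl) _ _ j⇝a → ⇝-asym Sa Sj a≢j a⇝j j⇝a ; (there i∈L) → j-sink i∈L }
      ...     | inj₁ j⇝a = a , Sa , a-sink
        where
        a-sink : ∀ {i} → i ∈ a ∷ L → S i → i ≢ a → ¬ a ⇝ i
        a-sink (here refl) _ i≢a = ⊥-elim (i≢a refl)
        a-sink {i} (there i∈L) Si i≢a a⇝i with i ≟ j
        ... | yes refl = ⇝-asym Si Sa (a≢j ∘ sym) j⇝a a⇝i
        ... | no i≢j = j-sink i∈L Si i≢j (⇝-trans Sj Sa Si (a≢j ∘ sym) (i≢a ∘ sym) (i≢j ∘ sym) j⇝a a⇝i)

    sink-exists : Satisfiable S → ∃ IsSink
    sink-exists S≠∅ with sink-among S≠∅ (allFin n)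
    ... | j , Sj , j-sink = j , Sj , λ Si → j-sink (∈-allFin _) Si

infix 4 _<[_]_ _≤[_]_

_<[_]_ : ℚ → Bool → ℚ → Set
a <[ true ] b = a <q b
a <[ false ] b = b <q a

_≤[_]_ : ℚ → Bool → ℚ → Set
a ≤[ true ] b = a ≤q b
a ≤[ false ] b = b ≤q a

nearEnd farEnd : Bool → ℚ → ℚ → ℚ
nearEnd o l h = if o then l else h
farEnd o l h = if o then h else l

<[]-trans : ∀ o → a <[ o ] b → b <[ o ] c → a <[ o ] c
<[]-trans true p q = <-trans p q
<[]-trans false p q = <-trans q p

≤[]-<[]-trans : ∀ o → a ≤[ o ] b → b <[ o ] c → a <[ o ] c
≤[]-<[]-trans true p q = ≤-<-trans p q
≤[]-<[]-trans false p q = <-≤-trans q p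

<[]-≤[]-trans : ∀ o → a <[ o ] b → b ≤[ o ] c → a <[ o ] c
<[]-≤[]-trans true p q = <-≤-trans p q
<[]-≤[]-trans false p q = ≤-<-trans q p

≤[]-trans : ∀ o → a ≤[ o ] b → b ≤[ o ] c → a ≤[ o ] c
≤[]-trans true p q = ≤-trans p q
≤[]-trans false p q = ≤-trans q p

≤[]-antisym : ∀ o → a ≤[ o ] b → b ≤[ o ] a → a ≡ b
≤[]-antisym true p q = ≤-antisym p q
≤[]-antisym false p q = ≤-antisym q p

<[]⇒≱[] : ∀ o → a <[ o ] b → ¬ b ≤[ o ] a
<[]⇒≱[] true p q = <-irrefl refl (<-≤-trans p q)
<[]⇒≱[] false p q = <-irrefl refl (<-≤-trans p q)

<[]⇒≤[] : ∀ o → a <[ o ] b → a ≤[ o ] b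
<[]⇒≤[] true p = <⇒≤ p
<[]⇒≤[] false p = <⇒≤ p

≮[]⇒≥[] : ∀ o → ¬ a <[ o ] b → b ≤[ o ] a
≮[]⇒≥[] true p = ≮⇒≥ p
≮[]⇒≥[] false p = ≮⇒≥ p

_<[_]?_ : ∀ a o b → Dec (a <[ o ] b)
a <[ true ]? b = a <? b
a <[ false ]? b = b <? a

<[]-dense : ∀ o → a <[ o ] b → ∃ λ m → a <[ o ] m × m <[ o ] b
<[]-dense true p = <-dense p
<[]-dense false p with <-dense p
... | m , p₁ , p₂ = m , p₂ , p₁

nearEnd<[]farEnd : ∀ o → l <q h → nearEnd o l h <[ o ] farEnd o l h
nearEnd<[]farEnd true p = p
nearEnd<[]farEnd false p = p

≤×≤⇒≤[] : ∀ o {x} → l ≤q x → x ≤q h → nearEnd o l h ≤[ o ] x × x ≤[ o ] farEnd o l h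
≤×≤⇒≤[] true p q = p , q
≤×≤⇒≤[] false p q = q , p

≤[]⇒≤×≤ : ∀ o {x} → nearEnd o l h ≤[ o ] x → x ≤[ o ] farEnd o l h → l ≤q x × x ≤q h
≤[]⇒≤×≤ true p q = p , q
≤[]⇒≤×≤ false p q = q , p

<[]⇒<×< : ∀ o {x} → nearEnd o l h <[ o ] x → x <[ o ] farEnd o l h → l <q x × x <q h
<[]⇒<×< true p q = p , q
<[]⇒<×< false p q = q , p

≤[]∧≢⇒<[] : ∀ o → a ≤[ o ] b → a ≢ b → a <[ o ] b
≤[]∧≢⇒<[] {a} {b} o a≤b a≢b with a <[ o ]? b
... | yes a<b = a<b
... | no a≮b = ⊥-elim (a≢b (≤[]-antisym o a≤b (≮[]⇒≥[] o a≮b)))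

<[]-dense-below : ∀ o {n} (r : Fin n → ℚ) → a <[ o ] b →
                  ∃ λ y → a <[ o ] y × y <[ o ] b × (∀ C → a <[ o ] r C → y <[ o ] r C)
<[]-dense-below o {ℕ.zero} r a<b with <[]-dense o a<b
... | y , a<y , y<b = y , a<y , y<b , λ ()
<[]-dense-below {a} {b} o {ℕ.suc n} r a<b with a <[ o ]? r zero | r zero <[ o ]? b
... | no a≮r₀ | _ with <[]-dense-below o (r ∘ Fin.suc) a<b
...   | y , a<y , y<b , below = y , a<y , y<b , λ { zero a<r₀ → ⊥-elim (a≮r₀ a<r₀) ; (Fin.suc C) → below C }
<[]-dense-below o r a<b | yes a<r₀ | yes r₀<b with <[]-dense-below o (r ∘ Fin.suc) a<r₀
...   | y , a<y , y<r₀ , below = y , a<y , <[]-trans o y<r₀ r₀<b , λ { zero _ → y<r₀ ; (Fin.suc C) → below C }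
<[]-dense-below o r a<b | yes a<r₀ | no r₀≮b with <[]-dense-below o (r ∘ Fin.suc) a<b
...   | y , a<y , y<b , below = y , a<y , y<b , λ { zero _ → <[]-≤[]-trans o y<b (≮[]⇒≥[] o r₀≮b) ; (Fin.suc C) → below C }

nested-ends : ∀ o {l' h'} → l' ≤q l → h ≤q h' → nearEnd o l' h' ≤[ o ] nearEnd o l h × farEnd o l h ≤[ o ] farEnd o l' h'
nested-ends true l'≤l h≤h' = l'≤l , h≤h'
nested-ends false l'≤l h≤h' = h≤h' , l'≤l

nearEnd-shared : ∀ o s {l' h'} → l' ≤q l → h ≤q h' → l ≤q farEnd s l' h' → farEnd s l' h' ≤q h →
                 farEnd o l h ≢ farEnd s l' h' → nearEnd o l h ≡ nearEnd o l' h'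
nearEnd-shared true true l'≤l h≤h' _ h'≤h h≢h' = ⊥-elim (h≢h' (≤-antisym h≤h' h'≤h))
nearEnd-shared true false l'≤l h≤h' l≤l' _ _ = ≤-antisym l≤l' l'≤l
nearEnd-shared false true l'≤l h≤h' _ h'≤h _ = ≤-antisym h≤h' h'≤h
nearEnd-shared false false l'≤l h≤h' l≤l' _ l≢l' = ⊥-elim (l≢l' (≤-antisym l≤l' l'≤l))

nearEnd-flip : ∀ o → (if not o then h else l) ≡ nearEnd o l h
nearEnd-flip true = refl
nearEnd-flip false = refl

farEnd-injective : ∀ o s → l <q h → farEnd o l h ≡ farEnd s l h → o ≡ s
farEnd-injective true true _ _ = refl
farEnd-injective true false l<h h≡l = ⊥-elim (<-irrefl (sym h≡l) l<h)
farEnd-injective false true l<h l≡h = ⊥-elim (<-irrefl l≡h l<h)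
farEnd-injective false false _ _ = refl

farEnd-inside : ∀ o {x} → a ≤q l → h ≤q b → a ≤q x → x ≤q b → l <q h → farEnd o l h <[ o ] x →
                a <q farEnd o l h × farEnd o l h <q b
farEnd-inside true a≤l _ _ x≤b l<h h<x = ≤-<-trans a≤l l<h , <-≤-trans h<x x≤b
farEnd-inside false _ h≤b a≤x _ l<h x<l = ≤-<-trans a≤x x<l , <-≤-trans l<h h≤b

crossing-ends : ∀ o {l' h'} → nearEnd o l h <[ o ] farEnd o l' h' → nearEnd o l' h' <[ o ] farEnd o l h →
                l <q h' × l' <q h
crossing-ends true p q = p , q
crossing-ends false p q = q , p

farEnd-either : ∀ o {x} → x ≡ farEnd o l h → x ≡ l ⊎ x ≡ h
farEnd-either true x≡h = inj₂ x≡h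
farEnd-either false x≡l = inj₁ x≡l

ends-equal : ∀ o {l' h'} → nearEnd o l h ≡ nearEnd o l' h' → farEnd o l h ≡ farEnd o l' h' → l ≡ l' × h ≡ h'
ends-equal true l≡l' h≡h' = l≡l' , h≡h'
ends-equal false h≡h' l≡l' = l≡l' , h≡h'

<-dense-below-both : a <q b → a <q c → ∃ λ z → a <q z × z <q b × z <q c
<-dense-below-both {b = b} {c = c} a<b a<c with ≤-total b c | <-dense a<b | <-dense a<c
... | inj₁ b≤c | z , a<z , z<b | _ = z , a<z , z<b , <-≤-trans z<b b≤c
... | inj₂ c≤b | _ | z , a<z , z<c = z , a<z , <-≤-trans z<c c≤b , z<c

open-intervals-meet : a <q b → c <q h → a <q h → c <q b →
                      ∃ λ z → (a <q z × z <q b) × (c <q z × z <q h)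
open-intervals-meet {a = a} {c = c} a<b c<h a<h c<b with ≤-total a c
... | inj₁ a≤c with <-dense-below-both c<b c<h
...   | z , c<z , z<b , z<h = z , (≤-<-trans a≤c c<z , z<b) , (c<z , z<h)
open-intervals-meet a<b c<h a<h c<b | inj₂ c≤a with <-dense-below-both a<b a<h
...   | z , a<z , z<b , z<h = z , (a<z , z<b) , (≤-<-trans c≤a a<z , z<h)

centre : Box d → Point d
centre X i = proj₁ (<-dense (lo<hi X i))

centre-∈B° : (X : Box d) → centre X ∈B° X
centre-∈B° X i = proj₂ (<-dense (lo<hi X i))

∈B°⇒∈B : (X : Box d) {x : Point d} → x ∈B° X → x ∈B X
∈B°⇒∈B X x∈X° i = <⇒≤ (proj₁ (x∈X° i)) , <⇒≤ (proj₂ (x∈X° i))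

corner-∈B : (X : Box d) (s : Fin d → Bool) → corner X s ∈B X
corner-∈B X s i with s i
... | true = <⇒≤ (lo<hi X i) , ≤-refl
... | false = ≤-refl , <⇒≤ (lo<hi X i)

∈B°⇒¬OnBoundary : (X : Box d) {x : Point d} → x ∈B° X → ¬ OnBoundary x X
∈B°⇒¬OnBoundary X x∈X° (_ , i , inj₁ x≡lo) = <-irrefl (sym x≡lo) (proj₁ (x∈X° i))
∈B°⇒¬OnBoundary X x∈X° (_ , i , inj₂ x≡hi) = <-irrefl x≡hi (proj₂ (x∈X° i))

interiors-meet : (X Y : Box d) → (∀ i → lo X i <q hi Y i × lo Y i <q hi X i) → ∃ λ x → x ∈B° X × x ∈B° Y
interiors-meet X Y crosses =
  (λ i → proj₁ (meet i)) , (λ i → proj₁ (proj₂ (meet i))) , (λ i → proj₂ (proj₂ (meet i)))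
  where
  meet : ∀ i → ∃ λ z → (lo X i <q z × z <q hi X i) × (lo Y i <q z × z <q hi Y i)
  meet i = open-intervals-meet (lo<hi X i) (lo<hi Y i) (proj₁ (crosses i)) (proj₂ (crosses i))

projectOnto : Box d → Fin d → Bool → Point d → Point d
projectOnto X j s x = updateAt x j (const (pos (blockFacet X j s)))

projectOnto-∈F : (X : Box d) (j : Fin d) (s : Bool) {x : Point d} → x ∈B X → projectOnto X j s x ∈F blockFacet X j s
projectOnto-∈F X j s {x} x∈X =
  updateAt-updates j x , λ i i≢j → subst (λ t → lo X i ≤q t × t ≤q hi X i) (sym (updateAt-minimal i j x i≢j)) (x∈X i)

blockFacet⊆block : (X : Box d) (j : Fin d) (s : Bool) {x : Point d} → x ∈F blockFacet X j s → x ∈B X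
blockFacet⊆block X j s {x} (x∈plane , x∈range) i with i ≟ j
... | no i≢j = x∈range i i≢j
... | yes refl with s
...   | true = subst (λ t → lo X i ≤q t × t ≤q hi X i) (sym x∈plane) (<⇒≤ (lo<hi X i) , ≤-refl)
...   | false = subst (λ t → lo X i ≤q t × t ≤q hi X i) (sym x∈plane) (≤-refl , <⇒≤ (lo<hi X i))

blockFacet⊆⇒range⊇ : (X : Box d) (j : Fin d) (s : Bool) (f : Facet d) → (∀ x → x ∈F blockFacet X j s → x ∈F f) →
                     ∀ i → i ≢ j → i ≢ axis f → flo f i ≤q lo X i × hi X i ≤q fhi f i
blockFacet⊆⇒range⊇ X j s f X⊆f i i≢j i≢axis =
  subst (flo f i ≤q_) (updateAt-minimal i j (lo X) i≢j) (proj₁ (range (lo X) (λ m → ≤-refl , <⇒≤ (lo<hi X m)))) ,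
  subst (_≤q fhi f i) (updateAt-minimal i j (hi X) i≢j) (proj₂ (range (hi X) (λ m → <⇒≤ (lo<hi X m) , ≤-refl)))
  where
  range : ∀ x → x ∈B X → flo f i ≤q projectOnto X j s x i × projectOnto X j s x i ≤q fhi f i
  range x x∈X = proj₂ (X⊆f _ (projectOnto-∈F X j s x∈X)) i i≢axis

another : ∀ {n} → 2 ≤ n → (k : Fin n) → ∃ λ l → l ≢ k
another (s≤s (s≤s _)) k = punchIn k zero , punchInᵢ≢i k zero

module _ (P : Floorplan d) where

  block⊆bbox : ∀ C i → lo (bbox P) i ≤q lo (block P C) i × hi (block P C) i ≤q hi (bbox P) i
  block⊆bbox C i =
    proj₁ (blockInside P C _ (corner-∈B (block P C) (const false)) i) ,
    proj₂ (blockInside P C _ (corner-∈B (block P C) (const true)) i)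

  border⊆bbox : ∀ {j t x} → InBorder P j t x → x ∈B bbox P
  border⊆bbox {j} (C , s , _ , x∈f) = blockInside P C _ (blockFacet⊆block (block P C) j s x∈f)

  block-filling-bbox-unique : ∀ k → (∀ i → lo (block P k) i ≡ lo (bbox P) i × hi (block P k) i ≡ hi (bbox P) i) →
                      ∀ l → l ≢ k → ⊥
  block-filling-bbox-unique k k-fills l l≢k = disjointInteriors P l k l≢k (interiors-meet (block P l) (block P k) crosses)
    where
    crosses : ∀ i → lo (block P l) i <q hi (block P k) i × lo (block P k) i <q hi (block P l) i
    crosses i =
      <-≤-trans (lo<hi (block P l) i) (subst (hi (block P l) i ≤q_) (sym (proj₂ (k-fills i))) (proj₂ (block⊆bbox l i))) ,
      ≤-<-trans (subst (_≤q lo (block P l) i) (sym (proj₁ (k-fills i))) (proj₁ (block⊆bbox l i))) (lo<hi (block P l) i)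

module Oriented (P : Floorplan d) (k : Fin (nBlocks P)) (o : Fin d → Bool) where

  B bb : Box d
  B = block P k
  bb = bbox P

  near far : Box d → Fin d → ℚ
  near X i = nearEnd (o i) (lo X i) (hi X i)
  far X i = farEnd (o i) (lo X i) (hi X i)

  q̄ : Point d
  q̄ = corner B o

  Inner : Pred (Fin d) 0ℓ
  Inner i = far B i <[ o i ] far bb i

  Overhangs : Rel (Fin d) 0ℓ
  Overhangs j i = ∃ λ x → InBorder P j (far B j) x × far B i <[ o i ] x i

  inner? : Decidable Inner
  inner? i = far B i <[ o i ]? far bb i

  open Tournaments Inner inner? Overhangs public

  ∈B⇒≤[] : ∀ X {x} → x ∈B X → ∀ i → near X i ≤[ o i ] x i × x i ≤[ o i ] far X i
  ∈B⇒≤[] X x∈X i = ≤×≤⇒≤[] (o i) (proj₁ (x∈X i)) (proj₂ (x∈X i))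

  near-bbox≤near : ∀ C i → near bb i ≤[ o i ] near (block P C) i
  near-bbox≤near C i = proj₁ (nested-ends (o i) (proj₁ (block⊆bbox P C i)) (proj₂ (block⊆bbox P C i)))

  far≤far-bbox : ∀ C i → far (block P C) i ≤[ o i ] far bb i
  far≤far-bbox C i = proj₂ (nested-ends (o i) (proj₁ (block⊆bbox P C i)) (proj₂ (block⊆bbox P C i)))

  near<[]far : ∀ X i → near X i <[ o i ] far X i
  near<[]far X i = nearEnd<[]farEnd (o i) (lo<hi X i)

  inner⇒InnerPos : ∀ {j} → Inner j → InnerPos P j (far B j)
  inner⇒InnerPos {j} inner = <[]⇒<×< (o j) (≤[]-<[]-trans (o j) (near-bbox≤near k j) (near<[]far B j)) inner

  ¬inner⇒far≡ : ∀ {i} → ¬ Inner i → far B i ≡ far bb i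
  ¬inner⇒far≡ {i} ¬inner = ≤[]-antisym (o i) (far≤far-bbox k i) (≮[]⇒≥[] (o i) ¬inner)

  q̄∈facet : ∀ j → q̄ ∈F blockFacet B j (o j)
  q̄∈facet j = refl , λ i _ → corner-∈B B o i

  facet⊆border : ∀ j {x} → x ∈F blockFacet B j (o j) → InBorder P j (far B j) x
  facet⊆border j x∈facet = k , o j , refl , x∈facet

  border-∋ridge : ∀ {i j} (f : Facet d) → axis f ≡ j → BorderIs P j (far B j) f → i ≢ j → Overhangs j i →
                  (z : Point d) → z j ≡ far B j → z i ≡ far B i →
                  (∀ m → m ≢ j → m ≢ i → lo B m <q z m × z m <q hi B m) → z ∈F° f
  border-∋ridge {i} f refl f-border i≢j (x , x∈border , x-beyond) z zj zi zm =
    trans zj (proj₁ (proj₁ (f-border q̄) (facet⊆border _ (q̄∈facet _)))) , λ m m≢j → inj₂ (inside m m≢j)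
    where
    j : Fin d
    j = axis f
    B-facet⊆f : ∀ y → y ∈F blockFacet B j (o j) → y ∈F f
    B-facet⊆f y y∈facet = proj₁ (f-border y) (facet⊆border j y∈facet)
    inside : ∀ m → m ≢ j → flo f m <q z m × z m <q fhi f m
    inside m m≢j with blockFacet⊆⇒range⊇ B j (o j) f B-facet⊆f m m≢j m≢j | m ≟ i
    ... | flo≤lo , hi≤fhi | yes refl =
      subst (λ t → flo f m <q t × t <q fhi f m) (sym zi)
        (farEnd-inside (o m) flo≤lo hi≤fhi (proj₁ x∈f) (proj₂ x∈f) (lo<hi B m) x-beyond)
      where
      x∈f : flo f m ≤q x m × x m ≤q fhi f m
      x∈f = proj₂ (proj₁ (f-border x) x∈border) m m≢j
    ... | flo≤lo , hi≤fhi | no m≢i =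
      ≤-<-trans flo≤lo (proj₁ (zm m m≢j m≢i)) , <-≤-trans (proj₂ (zm m m≢j m≢i)) hi≤fhi

  border-facet : Generic P → ∀ {j} → Inner j → Σ (Facet d) λ f → axis f ≡ j × BorderIs P j (far B j) f
  border-facet generic {j} inner = generic j (far B j) (inner⇒InnerPos inner) (q̄ , facet⊆border j (q̄∈facet j))

  overhangs-asym : Generic P → Tatami P → ∀ {i j} → Inner i → Inner j → i ≢ j → Overhangs i j → ¬ Overhangs j i
  overhangs-asym generic tatami {i} {j} Ii Ij i≢j i⇝j j⇝i
    with border-facet generic Ii | border-facet generic Ij
  ... | f , f-axis , f-border | g , g-axis , g-border =
    tatami i (far B i) j (far B j) (inner⇒InnerPos Ii) (inner⇒InnerPos Ij) (i≢j ∘ proj₁) f g f-border g-border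
      (z , border-∋ridge f f-axis f-border (i≢j ∘ sym) i⇝j z zi zj zm
         , border-∋ridge g g-axis g-border i≢j j⇝i z zj zi (λ m m≢j m≢i → zm m m≢i m≢j))
    where
    z : Point d
    z = projectOnto B i (o i) (projectOnto B j (o j) (centre B))
    zi : z i ≡ far B i
    zi = updateAt-updates i _
    zj : z j ≡ far B j
    zj = trans (updateAt-minimal j i _ (i≢j ∘ sym)) (updateAt-updates j _)
    zm : ∀ m → m ≢ i → m ≢ j → lo B m <q z m × z m <q hi B m
    zm m m≢i m≢j = subst (λ t → lo B m <q t × t <q hi B m)
      (sym (trans (updateAt-minimal m i _ m≢i) (updateAt-minimal m j _ m≢j))) (centre-∈B° B m)

  module Probe (S : Pred (Fin d) 0ℓ) (S? : Decidable S) (S⊆Inner : S ⊆ Inner) where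

    Beyond Within : Fin d → ℚ → Set
    Beyond i v = far B i <[ o i ] v × v <[ o i ] far bb i
                 × (∀ C → far B i <[ o i ] near (block P C) i → v <[ o i ] near (block P C) i)
    Within i v = near B i <[ o i ] v × v <[ o i ] far B i

    coordinate : ∀ i → Σ ℚ λ v → (S i × Beyond i v) ⊎ (¬ S i × Within i v)
    coordinate i with S? i
    ... | yes Si = let (v , far<v , v<far , below) = <[]-dense-below (o i) (λ C → near (block P C) i) (S⊆Inner Si)
                   in v , inj₁ (Si , far<v , v<far , below)
    ... | no ¬Si = let (v , near<v , v<far) = <[]-dense (o i) (near<[]far B i)
                   in v , inj₂ (¬Si , near<v , v<far)

    y : Point d
    y i = proj₁ (coordinate i)

    y-beyond : ∀ {i} → S i → Beyond i (y i)
    y-beyond {i} Si with proj₂ (coordinate i)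
    ... | inj₁ (_ , beyond) = beyond
    ... | inj₂ (¬Si , _) = ⊥-elim (¬Si Si)

    y-within : ∀ {i} → ¬ S i → Within i (y i)
    y-within {i} ¬Si with proj₂ (coordinate i)
    ... | inj₁ (Si , _) = ⊥-elim (¬Si Si)
    ... | inj₂ (_ , within) = within

    B<[]y<[]bbox : ∀ i → near B i <[ o i ] y i × y i <[ o i ] far bb i
    B<[]y<[]bbox i with proj₂ (coordinate i)
    ... | inj₁ (_ , far<y , y<far , _) = <[]-trans (o i) (near<[]far B i) far<y , y<far
    ... | inj₂ (_ , near<y , y<far) = near<y , <[]-≤[]-trans (o i) y<far (far≤far-bbox k i)

    y∈bbox : y ∈B bb
    y∈bbox i = ≤[]⇒≤×≤ (o i) (≤[]-trans (o i) (near-bbox≤near k i) (<[]⇒≤[] (o i) (proj₁ (B<[]y<[]bbox i))))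
                              (<[]⇒≤[] (o i) (proj₂ (B<[]y<[]bbox i)))

    C : Fin (nBlocks P)
    C = proj₁ (covers P y y∈bbox)

    y∈C : y ∈B block P C
    y∈C = proj₂ (covers P y y∈bbox)

    C≢k : Satisfiable S → C ≢ k
    C≢k (i , Si) C≡k = <[]⇒≱[] (o i) (proj₁ (y-beyond Si)) (proj₂ (∈B⇒≤[] B y∈B i))
      where
      y∈B : y ∈B B
      y∈B = subst (λ C′ → y ∈B block P C′) C≡k y∈C

    near-C≤[]far-B : ∀ {i} → S i → near (block P C) i ≤[ o i ] far B i
    near-C≤[]far-B {i} Si with far B i <[ o i ]? near (block P C) i
    ... | yes B<C = ⊥-elim (<[]⇒≱[] (o i) (proj₂ (proj₂ (y-beyond Si)) C B<C) (proj₁ (∈B⇒≤[] (block P C) y∈C i)))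
    ... | no B≮C = ≮[]⇒≥[] (o i) B≮C

    C-touches : Satisfiable S → ∃ λ j → S j × near (block P C) j ≡ far B j
    C-touches S≠∅ with any? (λ j → S? j ×-dec (near (block P C) j ≟q far B j))
    ... | yes touching = touching
    ... | no ¬touching = ⊥-elim (disjointInteriors P C k (C≢k S≠∅) (interiors-meet (block P C) B crosses))
      where
      C<[]B : ∀ i → near (block P C) i <[ o i ] far B i
      C<[]B i with S? i
      ... | yes Si = ≤[]∧≢⇒<[] (o i) (near-C≤[]far-B Si) (λ touch → ¬touching (i , Si , touch))
      ... | no ¬Si = ≤[]-<[]-trans (o i) (proj₁ (∈B⇒≤[] (block P C) y∈C i)) (proj₂ (y-within ¬Si))
      crosses : ∀ i → lo (block P C) i <q hi B i × lo B i <q hi (block P C) i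
      crosses i = crossing-ends (o i) (C<[]B i) (<[]-≤[]-trans (o i) (proj₁ (B<[]y<[]bbox i)) (proj₂ (∈B⇒≤[] (block P C) y∈C i)))

    touching⇒dominates : ∀ {j} → S j → near (block P C) j ≡ far B j → Dominates Overhangs S j
    touching⇒dominates {j} Sj touch {i} Si i≢j =
      x , (C , not (o j) , trans (nearEnd-flip (o j)) touch , projectOnto-∈F (block P C) j (not (o j)) y∈C) ,
      subst (far B i <[ o i ]_) (sym (updateAt-minimal i j y i≢j)) (proj₁ (y-beyond Si))
      where
      x : Point d
      x = projectOnto (block P C) j (not (o j)) y

  dominator : (S : Pred (Fin d) 0ℓ) → Decidable S → S ⊆ Inner → Satisfiable S → ∃ λ j → S j × Dominates Overhangs S j
  dominator S S? S⊆Inner S≠∅ with Probe.C-touches S S? S⊆Inner S≠∅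
  ... | j , Sj , touch = j , Sj , Probe.touching⇒dominates S S? S⊆Inner Sj touch

  near≡near-bbox : ∀ c → corner bb c ∈B B → (∀ i → q̄ i ≢ corner bb c i) → ∀ i → near B i ≡ near bb i
  near≡near-bbox c q∈B q̄≢q i =
    nearEnd-shared (o i) (c i) (proj₁ (block⊆bbox P k i)) (proj₂ (block⊆bbox P k i)) (proj₁ (q∈B i)) (proj₂ (q∈B i)) (q̄≢q i)

  inner⇒¬InBBoxBoundary : ∀ {j} → Inner j → ¬ InBBoxBoundary P (blockFacet B j (o j))
  inner⇒¬InBBoxBoundary {j} inner on-boundary =
    ∈B°⇒¬OnBoundary bb w∈bbox° (on-boundary w (projectOnto-∈F B j (o j) (∈B°⇒∈B B (centre-∈B° B))))
    where
    w : Point d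
    w = projectOnto B j (o j) (centre B)
    w∈bbox° : w ∈B° bb
    w∈bbox° i with i ≟ j
    ... | yes refl = subst (λ t → lo bb i <q t × t <q hi bb i) (sym (updateAt-updates i (centre B))) (inner⇒InnerPos inner)
    ... | no i≢j = subst (λ t → lo bb i <q t × t <q hi bb i) (sym (updateAt-minimal i j (centre B) i≢j))
                     (≤-<-trans (proj₁ (block⊆bbox P k i)) (proj₁ (centre-∈B° B i)) ,
                      <-≤-trans (proj₂ (centre-∈B° B i)) (proj₂ (block⊆bbox P k i)))

  ¬inner⇒InBBoxBoundary : ∀ {j} → ¬ Inner j → InBBoxBoundary P (blockFacet B j (o j))
  ¬inner⇒InBBoxBoundary {j} ¬inner x x∈facet =
    border⊆bbox P (facet⊆border j x∈facet) , j , farEnd-either (o j) (trans (proj₁ x∈facet) (¬inner⇒far≡ ¬inner))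

  self-border⇒¬overhangs : ∀ {j} → SelfBorder P (blockFacet B j (o j)) → ∀ i → ¬ Overhangs j i
  self-border⇒¬overhangs {j} self-border i (x , x∈border , beyond) =
    <[]⇒≱[] (o i) beyond (proj₂ (∈B⇒≤[] B (blockFacet⊆block B j (o j) (proj₁ (self-border x) x∈border)) i))

  shifting⇒sink : ∀ {j s} → Shifting P B q̄ j s → o j ≡ s × IsSink j
  shifting⇒sink {j} {s} (q̄∈facet′ , ¬boundary , self-border)
    with farEnd-injective (o j) s (lo<hi B j) (proj₁ q̄∈facet′)
  ... | refl = refl , inner , λ _ _ → self-border⇒¬overhangs self-border _
    where
    inner : Inner j
    inner with inner? j
    ... | yes inner = inner
    ... | no ¬inner = ⊥-elim (¬boundary (¬inner⇒InBBoxBoundary ¬inner))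

  module _ (generic : Generic P) (tatami : Tatami P) where

    shifting-unique : ∀ {j} → IsSink j → ∀ j′ s′ → Shifting P B q̄ j′ s′ → j′ ≡ j × s′ ≡ o j
    shifting-unique j-sink j′ s′ shifting with shifting⇒sink shifting
    ... | refl , j′-sink with sink-unique (overhangs-asym generic tatami) dominator j′-sink j-sink
    ... | refl = refl , refl

  module _ (near≡ : ∀ i → near B i ≡ near bb i) where

    sink-border⊆facet : ∀ {j} → IsSink j → ∀ {x} → InBorder P j (far B j) x → x ∈F blockFacet B j (o j)
    sink-border⊆facet {j} (_ , ¬overhangs) {x} x∈border@(_ , _ , pos≡ , x∈C-facet) =
      trans (proj₁ x∈C-facet) pos≡ , λ i i≢j → ≤[]⇒≤×≤ (o i) (lower i) (upper i i≢j)
      where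
      x≤bbox : ∀ i → near bb i ≤[ o i ] x i × x i ≤[ o i ] far bb i
      x≤bbox = ∈B⇒≤[] bb (border⊆bbox P x∈border)
      lower : ∀ i → near B i ≤[ o i ] x i
      lower i = subst (_≤[ o i ] x i) (sym (near≡ i)) (proj₁ (x≤bbox i))
      upper : ∀ i → i ≢ j → x i ≤[ o i ] far B i
      upper i i≢j with inner? i
      ... | yes inner = ≮[]⇒≥[] (o i) (λ beyond → ¬overhangs inner i≢j (x , x∈border , beyond))
      ... | no ¬inner = subst (x i ≤[ o i ]_) (sym (¬inner⇒far≡ ¬inner)) (proj₂ (x≤bbox i))

    sink⇒shifting : ∀ {j} → IsSink j → Shifting P B q̄ j (o j)
    sink⇒shifting {j} sink =
      q̄∈facet j , inner⇒¬InBBoxBoundary (proj₁ sink) , λ x → sink-border⊆facet sink , facet⊆border j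

    inner-exists : 2 ≤ nBlocks P → Satisfiable Inner
    inner-exists two with any? inner?
    ... | yes inner = inner
    ... | no ¬inner = ⊥-elim (block-filling-bbox-unique P k fills (proj₁ (another two k)) (proj₂ (another two k)))
      where
      fills : ∀ i → lo B i ≡ lo bb i × hi B i ≡ hi bb i
      fills i = ends-equal (o i) (near≡ i) (¬inner⇒far≡ (λ inner → ¬inner (i , inner)))

lemma2 : ∀ {d} (P : Floorplan d) → IsDFloorplan P → 2 ≤ nBlocks P →
         (c : Fin d → Bool) → (k : Fin (nBlocks P)) →
         corner (bbox P) c ∈B block P k →
         (c̄ : Fin d → Bool) →
         (∀ i → corner (block P k) c̄ i ≢ corner (bbox P) c i) →
         ∃[ j ] ∃[ s ] (Shifting P (block P k) (corner (block P k) c̄) j s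
                        × (∀ j' s' → Shifting P (block P k) (corner (block P k) c̄) j' s' →
                           (j' ≡ j) × (s' ≡ s)))
lemma2 {d} P (generic , tatami) two c k q∈B c̄ q̄≢q =
  j , c̄ j , sink⇒shifting near≡ j-sink , shifting-unique generic tatami j-sink
  where
  open Oriented P k c̄
  near≡ : ∀ i → near B i ≡ near bb i
  near≡ = near≡near-bbox c q∈B q̄≢q
  sink : ∃ IsSink
  sink = sink-exists (overhangs-asym generic tatami) dominator (inner-exists near≡ two)
  j : Fin d
  j = proj₁ sink
  j-sink : IsSink j
  j-sink = proj₂ sink
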